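{- Let $n\ge1$, let $\mathcal{F}\subset S_n$ with $|\mathcal{F}|=n!/2$, $f=2\chi_{\mathcal{F}}-1$, $f_1$ its orthogonal projection onto $U_1$, $\epsilon=\mathbb{E}[(f-f_1)^2]$, $a_{ij}=(n-1)\langle f,T_{ij}\rangle$, and call $a_{ij}$ large if $\big||a_{ij}|-1\big|\le50\epsilon^{1/7}$. Let $(X,Y)$ be a restriction with $m=|X|$, and suppose $(X,Y)$ is $q$-good for some $q<\frac{1}{4m}$. Then $(X,Y)$ has a $0$-strong line.
   Context: $T_{ij}=\{\sigma\in S_n:\sigma(i)=j\}$ (also its characteristic function); $U_1=\mathrm{span}\{T_{ij}\}$ with inner product $\langle f,g\rangle=\frac1{n!}\sum_\pi f(\pi)g(\pi)$. A restriction is a pair $(X,Y)$ with $X,Y\subset[n]$, $|X|=|Y|$. A generalized diagonal of $A[X,Y]=(a_{ij})_{i\in X,j\in Y}$ is $\{a_{i\sigma(i)}:i\in X\}$ for a bijection $\sigma:X\to Y$; it is good if it contains exactly one large entry. $(X,Y)$ is $q$-good if a uniformly random generalized diagonal of $A[X,Y]$ is good with probability at least $1-q$. For $i\in X$, row $i$ is $p$-strong for $(X,Y)$ if at least $(1-p)|Y|$ of the entries $a_{ij}$, $j\in Y$, are large; column $j\in Y$ is $p$-strong if at least $(1-p)|X|$ of the entries $a_{ij}$, $i\in X$, are large. $(X,Y)$ has a $p$-strong line if some row or column is $p$-strong for it.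
   Formalization: The parameter q in the hypothesis that (X,Y) is q-good for some q < 1/(4m) ranges over the rationals. -}

module Defs where

open import Data.Bool using (Bool; true; false; _∧_; _∨_; not; if_then_else_; T)
open import Data.Nat as ℕ using (ℕ; zero; suc; _∸_)
open import Data.Nat using (_!)
open import Data.Nat.Properties using (_!≢0)
open import Data.Integer using (+_; -[1+_])
open import Data.Fin using (Fin)
import Data.Fin as Fin
open import Data.Fin.Subset using (Subset; _∈_; _∉_)
open import Data.Fin.Subset.Properties using (_∈?_)
open import Data.Vec using (Vec; []; _∷_; lookup)
open import Data.List using (List; []; _∷_; map; concatMap; filterᵇ; foldr; allFin; length)
open import Data.Bool.ListAction using (and)
open import Data.Rational as ℚ using (ℚ; _+_; _*_; _-_; _≤_; _/_; ∣_∣; 0ℚ; 1ℚ)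
open import Relation.Nullary.Decidable using (⌊_⌋)
open import Data.Product using (Σ; _×_; ∃; ∃-syntax)
open import Data.Sum using (_⊎_)

ℕtoℚ : ℕ → ℚ
ℕtoℚ k = (+ k) / 1

_^ℚ_ : ℚ → ℕ → ℚ
x ^ℚ zero    = 1ℚ
x ^ℚ (suc k) = x * (x ^ℚ k)

sumℚ : {A : Set} → (A → ℚ) → List A → ℚ
sumℚ f = foldr (λ a s → f a + s) 0ℚ

countᵇ : {A : Set} → (A → Bool) → List A → ℕ
countᵇ p xs = length (filterᵇ p xs)

_≟ᵇ_ : {n : ℕ} → Fin n → Fin n → Bool
i ≟ᵇ j = ⌊ i Fin.≟ j ⌋

-- The symmetric group S_n, as the list of all injective (hence bijective)
-- maps Fin n → Fin n, written as vectors σ with σ(i) = lookup σ i.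

allVecs : (n k : ℕ) → List (Vec (Fin n) k)
allVecs n zero    = [] ∷ []
allVecs n (suc k) = concatMap (λ x → map (x ∷_) (allVecs n k)) (allFin n)

Perm : ℕ → Set
Perm n = Vec (Fin n) n

isInjectiveᵇ : {n : ℕ} → Perm n → Bool
isInjectiveᵇ {n} σ =
  and (concatMap (λ i → map (λ j → (i ≟ᵇ j) ∨ not (lookup σ i ≟ᵇ lookup σ j)) (allFin n)) (allFin n))

S : (n : ℕ) → List (Perm n)
S n = filterᵇ isInjectiveᵇ (allVecs n n)

inner : (n : ℕ) → (Perm n → ℚ) → (Perm n → ℚ) → ℚ
inner n f g = sumℚ (λ π → f π * g π) (S n) * ((+ 1) / (n !)) {{n !≢0}}

Tij : {n : ℕ} → Fin n → Fin n → Perm n → ℚ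
Tij i j σ = if lookup σ i ≟ᵇ j then 1ℚ else 0ℚ

-- a family F ⊆ S_n is given by its indicator (only values on S n matter)
card : (n : ℕ) → (Perm n → Bool) → ℕ
card n F = countᵇ F (S n)

fOf : {n : ℕ} → (Perm n → Bool) → Perm n → ℚ
fOf F π = if F π then 1ℚ else ℚ.- 1ℚ

spanT : {n : ℕ} → (Fin n → Fin n → ℚ) → Perm n → ℚ
spanT {n} c π = sumℚ (λ k → sumℚ (λ l → c k l * Tij k l π) (allFin n)) (allFin n)

-- g = Σ c_kl T_kl is the orthogonal projection f_1 of f onto U_1:
-- g ∈ U_1 and f − g ⊥ T_ij for all i, j.
IsProjection : (n : ℕ) → (Perm n → ℚ) → (Fin n → Fin n → ℚ) → Set
IsProjection n f c = ∀ i j → inner n (λ π → f π - spanT c π) (Tij i j) ≡ 0ℚ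
  where open import Relation.Binary.PropositionalEquality using (_≡_)

epsilon : (n : ℕ) → (Perm n → ℚ) → (Fin n → Fin n → ℚ) → ℚ
epsilon n f c = inner n (λ π → f π - spanT c π) (λ π → f π - spanT c π)

aCoef : (n : ℕ) → (Perm n → ℚ) → Fin n → Fin n → ℚ
aCoef n f i j = ℕtoℚ (n ∸ 1) * inner n f (Tij i j)

-- a is large iff | |a| − 1 | ≤ 50 ε^{1/7}; since both sides are ≥ 0 this
-- is stated (equivalently, avoiding real 7th roots) as
-- | |a| − 1 |^7 ≤ 50^7 ε.
Large : ℚ → ℚ → Set
Large ε a = (∣ ∣ a ∣ - 1ℚ ∣ ^ℚ 7) ≤ (ℕtoℚ 50 ^ℚ 7) * ε

largeᵇ : ℚ → ℚ → Bool
largeᵇ ε a = ⌊ (∣ ∣ a ∣ - 1ℚ ∣ ^ℚ 7) ℚ.≤? (ℕtoℚ 50 ^ℚ 7) * ε ⌋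

-- Restrictions and generalized diagonals.
-- A bijection σ : X → Y is encoded canonically as a vector v : Vec (Fin n) n
-- with v(i) ∈ Y for i ∈ X, v injective on X, and v(i) = i for i ∉ X.

memᵇ : {n : ℕ} → Fin n → Subset n → Bool
memᵇ i X = ⌊ i ∈? X ⌋

isDiagᵇ : {n : ℕ} → Subset n → Subset n → Vec (Fin n) n → Bool
isDiagᵇ {n} X Y v =
  and (map (λ i → if memᵇ i X then memᵇ (lookup v i) Y else (lookup v i ≟ᵇ i)) (allFin n))
  ∧ and (concatMap (λ i → map (λ j →
          not (memᵇ i X ∧ memᵇ j X) ∨ (i ≟ᵇ j) ∨ not (lookup v i ≟ᵇ lookup v j))
          (allFin n)) (allFin n))

diagonals : {n : ℕ} → Subset n → Subset n → List (Vec (Fin n) n)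
diagonals {n} X Y = filterᵇ (isDiagᵇ X Y) (allVecs n n)

isGoodᵇ : {n : ℕ} → (Fin n → Fin n → Bool) → Subset n → Vec (Fin n) n → Bool
isGoodᵇ {n} large X v =
  countᵇ (λ i → memᵇ i X ∧ large i (lookup v i)) (allFin n) ℕ.≡ᵇ 1

-- (X,Y) is q-good: P(random generalized diagonal is good) ≥ 1 − q, i.e.
-- #good ≥ (1 − q) · #diagonals
QGood : {n : ℕ} → (Fin n → Fin n → Bool) → Subset n → Subset n → ℚ → Set
QGood large X Y q =
  (1ℚ - q) * ℕtoℚ (length (diagonals X Y))
    ≤ ℕtoℚ (countᵇ (isGoodᵇ large X) (diagonals X Y))

HasZeroStrongLine : {n : ℕ} → (Fin n → Fin n → Set) → Subset n → Subset n → Set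
HasZeroStrongLine {n} Lg X Y =
  (∃[ i ] (i ∈ X × (∀ j → j ∈ Y → Lg i j)))
  ⊎ (∃[ j ] (j ∈ Y × (∀ i → i ∈ X → Lg i j)))

module Submission where

-- Only the pattern of large entries of A[X,Y] matters. Suppose no row or column
-- of A[X,Y] is entirely large. If no entry is large, every generalized diagonal
-- is bad. Otherwise take a large entry (i,c), a small entry (i,j) in its row and a
-- small entry (k,c) in its column, and split Y into U = {u : (i,u) large, (k,u)
-- small} ∋ c and V = Y ∖ U ∋ j. Column transpositions show that all ordered pairs
-- u ≠ v of Y are hit by the same number e of diagonals σ with σ(i) = u, σ(k) = v,
-- so there are at most m²e diagonals. For u ∈ U and v ∈ V, such a σ and the
-- diagonal obtained by exchanging σ(i) and σ(k) cannot both be good, so at least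
-- |U||V|e diagonals are bad. Since m = |U| + |V| ≤ 4|U||V|, the bad fraction is at
-- least 1/(4m) > q.

open import Data.Bool as Bool using (Bool; true; false; T; _∧_; _∨_; not; if_then_else_)
open import Data.Bool.ListAction using (and)
open import Data.Bool.Properties using (T-∧; T-≡; T-not-≡; ∧-conicalˡ; ∧-conicalʳ; not-injective)
open import Data.Empty using (⊥; ⊥-elim)
open import Data.Fin as Fin using (Fin; zero; suc)
open import Data.Fin.Permutation.Components using (transpose; transpose-inverse)
open import Data.Fin.Properties as Fin using (any?; all?; ¬∀⟶∃¬)
open import Data.Fin.Subset using (Subset; _∈_; _∉_; ∣_∣; _-_; ⁅_⁆; Nonempty; inside; outside)
open import Data.Fin.Subset.Properties using (_∈?_; drop-there; p─⊥≡p; p─q⊆p; x∈p∧x≢y⇒x∈p-y)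
import Data.Integer as ℤ
import Data.Integer.Properties as ℤ
import Data.Integer.Tactic.RingSolver as ℤ-Solver
open import Data.List using (List; []; _∷_; map; concat; concatMap; filterᵇ; allFin; _++_; length)
open import Data.List.Properties using (map-tabulate)
open import Data.List.Relation.Unary.All using (All; []; _∷_)
import Data.List.Relation.Unary.All.Properties as All
open import Data.Nat using (ℕ; zero; suc; _+_; _*_; _≤_; z≤n; s≤s; _≡ᵇ_; _!)
open import Data.Nat.Properties
open import Algebra.Properties.CommutativeSemigroup +-commutativeSemigroup using (interchange)
open import Data.Nat.Tactic.RingSolver using (solve-∀)
open import Data.Product using (_×_; _,_; proj₁; proj₂; ∃-syntax)
open import Data.Rational as ℚ using (ℚ; 0ℚ; 1ℚ; toℚᵘ)
import Data.Rational.Properties as ℚ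
open import Data.Rational.Solver using (module +-*-Solver)
open import Data.Rational.Unnormalised as ℚᵘ using (ℚᵘ; mkℚᵘ; _≃_; *≡*; *≤*; *<*)
import Data.Rational.Unnormalised.Properties as ℚᵘ
open import Data.Sum using (inj₁; inj₂)
open import Data.Vec as Vec using (Vec; []; _∷_; here; there; lookup; _[_]≔_)
import Data.Vec.Properties as Vec
open import Function using (_∘_; id; case_of_)
open import Function.Bundles using (Equivalence)
open import Relation.Binary.Definitions using (DecidableEquality)
open import Relation.Binary.PropositionalEquality
open import Relation.Nullary using (Dec; does; yes; no; ¬_; contradiction)
open import Relation.Nullary.Decidable
  using (toWitness; fromWitness; fromWitnessFalse; ⌊⌋-map′; decidable-stable; _×-dec_; _→-dec_; _⊎-dec_)
open import Relation.Nullary.Reflects using (Reflects; ofʸ; fromEquivalence; det)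

open import Defs
  using ( countᵇ; allVecs; memᵇ; _≟ᵇ_; isDiagᵇ; isGoodᵇ; diagonals; HasZeroStrongLine; QGood
        ; Perm; card; IsProjection; fOf; epsilon; aCoef; largeᵇ; Large; ℕtoℚ )

private variable
  A B : Set
  n : ℕ

𝟙 : Bool → ℕ
𝟙 true  = 1
𝟙 false = 0

∑ : (A → ℕ) → List A → ℕ
∑ f []       = 0
∑ f (x ∷ xs) = f x + ∑ f xs

countᵇ≡∑𝟙 : (p : A → Bool) (xs : List A) → countᵇ p xs ≡ ∑ (𝟙 ∘ p) xs
countᵇ≡∑𝟙 p [] = refl
countᵇ≡∑𝟙 p (x ∷ xs) with p x
... | true  = cong suc (countᵇ≡∑𝟙 p xs)
... | false = countᵇ≡∑𝟙 p xs

∑-cong : {f g : A → ℕ} (xs : List A) → (∀ x → f x ≡ g x) → ∑ f xs ≡ ∑ g xs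
∑-cong []       f≗g = refl
∑-cong (x ∷ xs) f≗g = cong₂ _+_ (f≗g x) (∑-cong xs f≗g)

∑-mono-≤ : {f g : A → ℕ} (xs : List A) → (∀ x → f x ≤ g x) → ∑ f xs ≤ ∑ g xs
∑-mono-≤ []       f≤g = z≤n
∑-mono-≤ (x ∷ xs) f≤g = +-mono-≤ (f≤g x) (∑-mono-≤ xs f≤g)

∑-zero : (xs : List A) → ∑ (λ _ → 0) xs ≡ 0
∑-zero []       = refl
∑-zero (x ∷ xs) = ∑-zero xs

∑-+ : (f g : A → ℕ) (xs : List A) → ∑ (λ x → f x + g x) xs ≡ ∑ f xs + ∑ g xs
∑-+ f g []       = refl
∑-+ f g (x ∷ xs) =
  trans (cong (f x + g x +_) (∑-+ f g xs)) (interchange (f x) (g x) (∑ f xs) (∑ g xs))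

∑-*ʳ : (f : A → ℕ) (c : ℕ) (xs : List A) → ∑ (λ x → f x * c) xs ≡ ∑ f xs * c
∑-*ʳ f c []       = refl
∑-*ʳ f c (x ∷ xs) = trans (cong (f x * c +_) (∑-*ʳ f c xs)) (sym (*-distribʳ-+ c (f x) (∑ f xs)))

∑-*ˡ : (c : ℕ) (f : A → ℕ) (xs : List A) → ∑ (λ x → c * f x) xs ≡ c * ∑ f xs
∑-*ˡ c f xs = trans (∑-cong xs (λ x → *-comm c (f x))) (trans (∑-*ʳ f c xs) (*-comm (∑ f xs) c))

∑-++ : (f : A → ℕ) (xs ys : List A) → ∑ f (xs ++ ys) ≡ ∑ f xs + ∑ f ys
∑-++ f []       ys = refl
∑-++ f (x ∷ xs) ys = trans (cong (f x +_) (∑-++ f xs ys)) (sym (+-assoc (f x) (∑ f xs) (∑ f ys)))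

∑-filterᵇ : (f : A → ℕ) (p : A → Bool) (xs : List A) →
            ∑ f (filterᵇ p xs) ≡ ∑ (λ x → 𝟙 (p x) * f x) xs
∑-filterᵇ f p [] = refl
∑-filterᵇ f p (x ∷ xs) with p x
... | true  = cong₂ _+_ (sym (+-identityʳ (f x))) (∑-filterᵇ f p xs)
... | false = ∑-filterᵇ f p xs

∑-comm : (f : A → B → ℕ) (xs : List A) (ys : List B) →
         ∑ (λ x → ∑ (f x) ys) xs ≡ ∑ (λ y → ∑ (λ x → f x y) xs) ys
∑-comm f []       ys = sym (∑-zero ys)
∑-comm f (x ∷ xs) ys =
  trans (cong (∑ (f x) ys +_) (∑-comm f xs ys)) (sym (∑-+ (f x) (λ y → ∑ (λ x → f x y) xs) ys))

∑-map : (f : B → ℕ) (g : A → B) (xs : List A) → ∑ f (map g xs) ≡ ∑ (f ∘ g) xs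
∑-map f g []       = refl
∑-map f g (x ∷ xs) = cong (f (g x) +_) (∑-map f g xs)

∑-concatMap : (f : B → ℕ) (g : A → List B) (xs : List A) →
              ∑ f (concatMap g xs) ≡ ∑ (λ x → ∑ f (g x)) xs
∑-concatMap f g []       = refl
∑-concatMap f g (x ∷ xs) =
  trans (∑-++ f (g x) (concat (map g xs))) (cong (∑ f (g x) +_) (∑-concatMap f g xs))

∑-allFin-suc : ∀ n (f : Fin (suc n) → ℕ) → ∑ f (allFin (suc n)) ≡ f zero + ∑ (f ∘ suc) (allFin n)
∑-allFin-suc n f = cong (f zero +_) (trans (cong (∑ f) (sym (map-tabulate id suc))) (∑-map f suc (allFin n)))

𝟙*-≤ : ∀ b m → 𝟙 b * m ≤ m
𝟙*-≤ true  m = ≤-reflexive (*-identityˡ m)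
𝟙*-≤ false m = z≤n

1*1*x≡x : ∀ x → 1 * (1 * x) ≡ x
1*1*x≡x x = trans (*-identityˡ (1 * x)) (*-identityˡ x)

𝟙-disjoint-≤ : ∀ a b c d w → a ∧ d ≡ false → 𝟙 a * (𝟙 b * w) + 𝟙 c * (𝟙 d * w) ≤ w
𝟙-disjoint-≤ false b c d     w _ = ≤-trans (𝟙*-≤ c _) (𝟙*-≤ d w)
𝟙-disjoint-≤ true  b c false w _ = begin
  1 * (𝟙 b * w) + 𝟙 c * 0 ≡⟨ cong₂ _+_ (*-identityˡ _) (*-zeroʳ (𝟙 c)) ⟩
  𝟙 b * w + 0             ≡⟨ +-identityʳ _ ⟩
  𝟙 b * w                 ≤⟨ 𝟙*-≤ b w ⟩
  w                       ∎
  where open ≤-Reasoning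

m+n≤4mn : ∀ {m n} → 1 ≤ m → 1 ≤ n → m + n ≤ 4 * (m * n)
m+n≤4mn {m} {n} 1≤m 1≤n = begin
  m + n                           ≤⟨ +-mono-≤ m≤mn n≤mn ⟩
  m * n + m * n                   ≤⟨ m≤m+n (m * n + m * n) (m * n + m * n) ⟩
  m * n + m * n + (m * n + m * n) ≡⟨ four (m * n) ⟩
  4 * (m * n)                     ∎
  where
  open ≤-Reasoning
  m≤mn = subst (_≤ m * n) (*-identityʳ m) (*-monoʳ-≤ m 1≤n)
  n≤mn = subst (_≤ m * n) (*-identityˡ n) (*-monoˡ-≤ n 1≤m)
  four : ∀ x → x + x + (x + x) ≡ 4 * x
  four = solve-∀

-- Kronecker deltas and complete enumerations

module _ (_≟_ : DecidableEquality A) where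

  δ : A → A → ℕ
  δ x y = 𝟙 (does (x ≟ y))

  δ-cong-⇔ : ∀ {x y x′ y′} → (x ≡ y → x′ ≡ y′) → (x′ ≡ y′ → x ≡ y) → δ x y ≡ δ x′ y′
  δ-cong-⇔ {x} {y} {x′} {y′} to from with x ≟ y | x′ ≟ y′
  ... | yes _   | yes _    = refl
  ... | no  _   | no  _    = refl
  ... | yes x≡y | no x′≢y′ = contradiction (to x≡y) x′≢y′
  ... | no  x≢y | yes x′≡y′ = contradiction (from x′≡y′) x≢y

  δ-sym : ∀ x y → δ x y ≡ δ y x
  δ-sym x y = δ-cong-⇔ sym sym

  ∑-δ* : (a : A) (g : A → ℕ) (xs : List A) → ∑ (λ z → δ a z * g z) xs ≡ ∑ (δ a) xs * g a
  ∑-δ* a g xs = trans (∑-cong xs δ*g≡δ*ga) (∑-*ʳ (δ a) (g a) xs)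
    where
    δ*g≡δ*ga : ∀ z → δ a z * g z ≡ δ a z * g a
    δ*g≡δ*ga z with a ≟ z
    ... | yes refl = refl
    ... | no  _    = refl

  OccursOnce : List A → Set
  OccursOnce L = ∀ z → ∑ (λ x → δ x z) L ≡ 1

  module _ (L : List A) (once : OccursOnce L) where

    ∑-δ-one : (a : A) → ∑ (δ a) L ≡ 1
    ∑-δ-one a = trans (∑-cong L (δ-sym a)) (once a)

    ∑-δ : (a : A) (g : A → ℕ) → ∑ (λ z → δ a z * g z) L ≡ g a
    ∑-δ a g = trans (∑-δ* a g L) (trans (cong (_* g a) (∑-δ-one a)) (*-identityˡ (g a)))

    ≤-∑ : (g : A → ℕ) (a : A) → g a ≤ ∑ g L
    ≤-∑ g a = subst (_≤ ∑ g L) (∑-δ a g) (∑-mono-≤ L (λ z → 𝟙*-≤ (does (a ≟ z)) (g z)))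

    ∑-∘-inverse : (φ ψ : A → A) → (∀ x → ψ (φ x) ≡ x) → (∀ z → φ (ψ z) ≡ z) →
                  (f : A → ℕ) → ∑ (f ∘ φ) L ≡ ∑ f L
    ∑-∘-inverse φ ψ ψφ φψ f = begin
      ∑ (f ∘ φ) L                                  ≡⟨ ∑-cong L (λ x → sym (∑-δ (φ x) f)) ⟩
      ∑ (λ x → ∑ (λ z → δ (φ x) z * f z) L) L      ≡⟨ ∑-comm (λ x z → δ (φ x) z * f z) L L ⟩
      ∑ (λ z → ∑ (λ x → δ (φ x) z * f z) L) L      ≡⟨ ∑-cong L (λ z → ∑-cong L (λ x → cong (_* f z) (δ-φ x z))) ⟩
      ∑ (λ z → ∑ (λ x → δ x (ψ z) * f z) L) L      ≡⟨ ∑-cong L (λ z → ∑-*ʳ (λ x → δ x (ψ z)) (f z) L) ⟩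
      ∑ (λ z → ∑ (λ x → δ x (ψ z)) L * f z) L      ≡⟨ ∑-cong L (λ z → trans (cong (_* f z) (once (ψ z))) (*-identityˡ (f z))) ⟩
      ∑ f L                                        ∎
      where
      open ≡-Reasoning
      δ-φ : ∀ x z → δ (φ x) z ≡ δ x (ψ z)
      δ-φ x z = δ-cong-⇔ (λ φx≡z → trans (sym (ψφ x)) (cong ψ φx≡z)) (λ x≡ψz → trans (cong φ x≡ψz) (φψ z))

allFin-once : ∀ n → OccursOnce Fin._≟_ (allFin n)
allFin-once (suc n) z = trans (∑-allFin-suc n (λ x → δ Fin._≟_ x z)) (once-at z)
  where
  once-at : ∀ z → δ Fin._≟_ zero z + ∑ (λ x → δ Fin._≟_ (suc x) z) (allFin n) ≡ 1
  once-at zero     = cong suc (∑-zero (allFin n))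
  once-at (suc z)  = allFin-once n z

allVecs-once : ∀ n k → OccursOnce (Vec.≡-dec Fin._≟_) (allVecs n k)
allVecs-once n zero    []       = refl
allVecs-once n (suc k) (z ∷ zs) = begin
  ∑ (λ v → δ _≟ᵥ_ v (z ∷ zs)) (allVecs n (suc k))
    ≡⟨ ∑-concatMap _ (λ x → map (x ∷_) (allVecs n k)) (allFin n) ⟩
  ∑ (λ x → ∑ (λ v → δ _≟ᵥ_ v (z ∷ zs)) (map (x ∷_) (allVecs n k))) (allFin n)
    ≡⟨ ∑-cong (allFin n) (λ x → ∑-map _ (x ∷_) (allVecs n k)) ⟩
  ∑ (λ x → ∑ (λ v → 𝟙 (does (x Fin.≟ z) ∧ does (v ≟ᵥ zs))) (allVecs n k)) (allFin n)
    ≡⟨ ∑-cong (allFin n) (λ x → ∑-cong (allVecs n k) (λ v → 𝟙-∧ (does (x Fin.≟ z)) _)) ⟩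
  ∑ (λ x → ∑ (λ v → δ Fin._≟_ x z * δ _≟ᵥ_ v zs) (allVecs n k)) (allFin n)
    ≡⟨ ∑-cong (allFin n) (λ x → ∑-*ˡ (δ Fin._≟_ x z) _ (allVecs n k)) ⟩
  ∑ (λ x → δ Fin._≟_ x z * ∑ (λ v → δ _≟ᵥ_ v zs) (allVecs n k)) (allFin n)
    ≡⟨ ∑-cong (allFin n) (λ x → cong (δ Fin._≟_ x z *_) (allVecs-once n k zs)) ⟩
  ∑ (λ x → δ Fin._≟_ x z * 1) (allFin n)
    ≡⟨ ∑-*ʳ (λ x → δ Fin._≟_ x z) 1 (allFin n) ⟩
  ∑ (λ x → δ Fin._≟_ x z) (allFin n) * 1
    ≡⟨ cong (_* 1) (allFin-once n z) ⟩
  1 ∎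
  where
  open ≡-Reasoning
  _≟ᵥ_ : ∀ {k} → DecidableEquality (Vec (Fin n) k)
  _≟ᵥ_ = Vec.≡-dec Fin._≟_
  𝟙-∧ : ∀ a b → 𝟙 (a ∧ b) ≡ 𝟙 a * 𝟙 b
  𝟙-∧ true  b = sym (+-identityʳ (𝟙 b))
  𝟙-∧ false b = refl

δᶠ : Fin n → Fin n → ℕ
δᶠ = δ Fin._≟_

∑-δᶠ-one : (a : Fin n) → ∑ (δᶠ a) (allFin n) ≡ 1
∑-δᶠ-one {n} = ∑-δ-one Fin._≟_ (allFin n) (allFin-once n)

∑-memᵇ≡∣∣ : (Y : Subset n) → ∑ (λ u → 𝟙 (memᵇ u Y)) (allFin n) ≡ ∣ Y ∣
∑-memᵇ≡∣∣ []      = refl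
∑-memᵇ≡∣∣ {suc n} (s ∷ Y) = trans (∑-allFin-suc n (λ u → 𝟙 (memᵇ u (s ∷ Y)))) (first s (trans
    (∑-cong (allFin n) (λ u → cong 𝟙 (⌊⌋-map′ there drop-there (u ∈? Y)))) (∑-memᵇ≡∣∣ Y)))
  where
  first : ∀ s {m} → m ≡ ∣ Y ∣ → 𝟙 (memᵇ zero (s ∷ Y)) + m ≡ ∣ s ∷ Y ∣
  first inside  = cong suc
  first outside = id

∑² : (Fin n → Fin n → ℕ) → ℕ
∑² {n} f = ∑ (λ u → ∑ (f u) (allFin n)) (allFin n)

∑²-mono-≤ : {f g : Fin n → Fin n → ℕ} → (∀ u v → f u v ≤ g u v) → ∑² f ≤ ∑² g
∑²-mono-≤ {n} f≤g = ∑-mono-≤ (allFin n) (λ u → ∑-mono-≤ (allFin n) (f≤g u))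

∑²-cong : {f g : Fin n → Fin n → ℕ} → (∀ u v → f u v ≡ g u v) → ∑² f ≡ ∑² g
∑²-cong {n} f≗g = ∑-cong (allFin n) (λ u → ∑-cong (allFin n) (f≗g u))

∑²-+ : (f g : Fin n → Fin n → ℕ) → ∑² (λ u v → f u v + g u v) ≡ ∑² f + ∑² g
∑²-+ {n} f g = trans (∑-cong (allFin n) (λ u → ∑-+ (f u) (g u) (allFin n))) (∑-+ _ _ (allFin n))

∑²-flip : (f : Fin n → Fin n → ℕ) → ∑² (λ u v → f v u) ≡ ∑² f
∑²-flip {n} f = ∑-comm (λ u v → f v u) (allFin n) (allFin n)

∑²-* : (f g : Fin n → ℕ) (e : ℕ) → ∑² (λ u v → f u * (g v * e)) ≡ ∑ f (allFin n) * (∑ g (allFin n) * e)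
∑²-* {n} f g e = begin
  ∑² (λ u v → f u * (g v * e))                            ≡⟨ ∑-cong (allFin n) (λ u → ∑-*ˡ (f u) _ (allFin n)) ⟩
  ∑ (λ u → f u * ∑ (λ v → g v * e) (allFin n)) (allFin n) ≡⟨ ∑-*ʳ f _ (allFin n) ⟩
  ∑ f (allFin n) * ∑ (λ v → g v * e) (allFin n)           ≡⟨ cong (∑ f (allFin n) *_) (∑-*ʳ g e (allFin n)) ⟩
  ∑ f (allFin n) * (∑ g (allFin n) * e)                   ∎
  where open ≡-Reasoning

module _ {n : ℕ} {i k : Fin n} (i≢k : i ≢ k) (P Q : Fin n → Bool)
         (agree : ∀ p → p ≢ i → p ≢ k → P p ≡ Q p) where

  private
    pointwise : ∀ x → 𝟙 (P x) + (δᶠ x i * 𝟙 (Q i) + δᶠ x k * 𝟙 (Q k))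
                    ≡ 𝟙 (Q x) + (δᶠ x i * 𝟙 (P i) + δᶠ x k * 𝟙 (P k))
    pointwise x with x Fin.≟ i | x Fin.≟ k
    ... | yes refl | yes refl = contradiction refl i≢k
    ... | yes refl | no  _    = at-i (𝟙 (P x)) (𝟙 (Q x)) (𝟙 (Q k)) (𝟙 (P k))
      where at-i : ∀ a b c d → a + (1 * b + 0 * c) ≡ b + (1 * a + 0 * d)
            at-i = solve-∀
    ... | no  _    | yes refl = at-k (𝟙 (P x)) (𝟙 (Q x)) (𝟙 (Q i)) (𝟙 (P i))
      where at-k : ∀ a b c d → a + (0 * c + 1 * b) ≡ b + (0 * d + 1 * a)
            at-k = solve-∀
    ... | no  x≢i  | no  x≢k  = cong (λ b → 𝟙 b + (0 + 0)) (agree x x≢i x≢k)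

  count-agree-off-two : countᵇ P (allFin n) + (𝟙 (Q i) + 𝟙 (Q k)) ≡ countᵇ Q (allFin n) + (𝟙 (P i) + 𝟙 (P k))
  count-agree-off-two = trans (expand P Q) (trans (∑-cong (allFin n) pointwise) (sym (expand Q P)))
    where
    ∑-δᶠ* : ∀ a c → ∑ (λ x → δᶠ x a * c) (allFin n) ≡ c
    ∑-δᶠ* a c = trans (∑-*ʳ (λ x → δᶠ x a) c (allFin n)) (trans (cong (_* c) (allFin-once n a)) (*-identityˡ c))

    expand : ∀ R S → countᵇ R (allFin n) + (𝟙 (S i) + 𝟙 (S k))
                   ≡ ∑ (λ x → 𝟙 (R x) + (δᶠ x i * 𝟙 (S i) + δᶠ x k * 𝟙 (S k))) (allFin n)
    expand R S = sym (begin
      ∑ (λ x → 𝟙 (R x) + (δᶠ x i * 𝟙 (S i) + δᶠ x k * 𝟙 (S k))) (allFin n)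
        ≡⟨ ∑-+ (𝟙 ∘ R) _ (allFin n) ⟩
      ∑ (𝟙 ∘ R) (allFin n) + ∑ (λ x → δᶠ x i * 𝟙 (S i) + δᶠ x k * 𝟙 (S k)) (allFin n)
        ≡⟨ cong₂ _+_ (sym (countᵇ≡∑𝟙 R (allFin n))) (∑-+ _ _ (allFin n)) ⟩
      countᵇ R (allFin n) + (∑ (λ x → δᶠ x i * 𝟙 (S i)) (allFin n) + ∑ (λ x → δᶠ x k * 𝟙 (S k)) (allFin n))
        ≡⟨ cong (countᵇ R (allFin n) +_) (cong₂ _+_ (∑-δᶠ* i (𝟙 (S i))) (∑-δᶠ* k (𝟙 (S k)))) ⟩
      countᵇ R (allFin n) + (𝟙 (S i) + 𝟙 (S k)) ∎)
      where open ≡-Reasoning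

memᵇ⇒∈ : ∀ {x} {X : Subset n} → memᵇ x X ≡ true → x ∈ X
memᵇ⇒∈ eq = toWitness (Equivalence.from T-≡ eq)

∈⇒memᵇ : ∀ {x} {X : Subset n} → x ∈ X → memᵇ x X ≡ true
∈⇒memᵇ x∈X = Equivalence.to T-≡ (fromWitness x∈X)

∉⇒memᵇ : ∀ {x} {X : Subset n} → x ∉ X → memᵇ x X ≡ false
∉⇒memᵇ x∉X = Equivalence.to T-not-≡ (fromWitnessFalse x∉X)

¬all⇒∃false : (Z : Subset n) (f : Fin n → Bool) → ¬ (∀ j → j ∈ Z → f j ≡ true) → ∃[ j ] (j ∈ Z × f j ≡ false)
¬all⇒∃false {n} Z f ¬all with ¬∀⟶∃¬ n (λ j → j ∈ Z → f j ≡ true) (λ j → j ∈? Z →-dec f j Bool.≟ true) ¬all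
... | j , ¬P with j ∈? Z | f j in fj
...   | no  j∉Z | _     = contradiction (λ j∈Z → contradiction j∈Z j∉Z) ¬P
...   | yes _   | true  = contradiction (λ _ → refl) ¬P
...   | yes j∈Z | false = j , j∈Z , fj

∣p∣≡0⇒x∉p : ∀ {p : Subset n} {x} → ∣ p ∣ ≡ 0 → x ∉ p
∣p∣≡0⇒x∉p {p = outside ∷ p} ∣p∣≡0 (there x∈p) = ∣p∣≡0⇒x∉p {p = p} ∣p∣≡0 x∈p

∣p∣≡suc⇒nonempty : ∀ (p : Subset n) {k} → ∣ p ∣ ≡ suc k → Nonempty p
∣p∣≡suc⇒nonempty (inside  ∷ p) _ = zero , here
∣p∣≡suc⇒nonempty (outside ∷ p) ∣p∣≡1+k =
  let x , x∈p = ∣p∣≡suc⇒nonempty p ∣p∣≡1+k in suc x , there x∈p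

x∈p⇒1+∣p-x∣≡∣p∣ : ∀ {p : Subset n} {x} → x ∈ p → suc ∣ p - x ∣ ≡ ∣ p ∣
x∈p⇒1+∣p-x∣≡∣p∣ {p = inside ∷ p}  here = cong (suc ∘ ∣_∣) (p─⊥≡p p)
x∈p⇒1+∣p-x∣≡∣p∣ {p = inside ∷ p}  (there x∈p) = cong suc (x∈p⇒1+∣p-x∣≡∣p∣ x∈p)
x∈p⇒1+∣p-x∣≡∣p∣ {p = outside ∷ p} (there x∈p) = x∈p⇒1+∣p-x∣≡∣p∣ x∈p

x∈p-y⇒x≢y : ∀ {p : Subset n} {x y} → x ∈ p - y → x ≢ y
x∈p-y⇒x≢y {p = _ ∷ p} {x = zero}  {zero}  ()
x∈p-y⇒x≢y {p = _ ∷ p} {x = zero}  {suc y} here   = λ ()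
x∈p-y⇒x≢y {p = _ ∷ p} {x = suc x} {zero}  _      = λ ()
x∈p-y⇒x≢y {p = _ ∷ p} {x = suc x} {suc y} (there x∈p-y) = x∈p-y⇒x≢y x∈p-y ∘ Fin.suc-injective

-- Generalized diagonals

Assignment : ℕ → Set
Assignment n = Vec (Fin n) n

record IsDiagonal {n : ℕ} (X Y : Subset n) (v : Assignment n) : Set where
  field
    maps-into     : ∀ {i} → i ∈ X → lookup v i ∈ Y
    fixes-outside : ∀ {i} → i ∉ X → lookup v i ≡ i
    injective-on  : ∀ {i j} → i ∈ X → j ∈ X → lookup v i ≡ lookup v j → i ≡ j
open IsDiagonal

T-and⁻ : ∀ bs → T (and bs) → All T bs
T-and⁻ []           _ = []
T-and⁻ (true ∷ bs)  t = _ ∷ T-and⁻ bs t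

T-and⁺ : ∀ {bs} → All T bs → T (and bs)
T-and⁺ []                  = _
T-and⁺ {true ∷ _} (_ ∷ ts) = T-and⁺ ts

module _ {n : ℕ} where

  T-and-allFin⁻ : (f : Fin n → Bool) → T (and (map f (allFin n))) → ∀ i → T (f i)
  T-and-allFin⁻ f t = All.tabulate⁻ (All.map⁻ (T-and⁻ _ t))

  T-and-allFin⁺ : (f : Fin n → Bool) → (∀ i → T (f i)) → T (and (map f (allFin n)))
  T-and-allFin⁺ f t = T-and⁺ (All.map⁺ (All.tabulate⁺ t))

  T-and-allFin²⁻ : (g : Fin n → Fin n → Bool) →
    T (and (concatMap (λ i → map (g i) (allFin n)) (allFin n))) → ∀ i j → T (g i j)
  T-and-allFin²⁻ g t i =
    All.tabulate⁻ (All.map⁻ (All.tabulate⁻ (All.map⁻ (All.concat⁻ (T-and⁻ _ t))) i))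

  T-and-allFin²⁺ : (g : Fin n → Fin n → Bool) → (∀ i j → T (g i j)) →
    T (and (concatMap (λ i → map (g i) (allFin n)) (allFin n)))
  T-and-allFin²⁺ g t =
    T-and⁺ (All.concat⁺ (All.map⁺ (All.tabulate⁺ (λ i → All.map⁺ (All.tabulate⁺ (t i))))))

module _ {n : ℕ} (X Y : Subset n) (v : Assignment n) where

  private
    placed : Fin n → Bool
    placed i = if memᵇ i X then memᵇ (lookup v i) Y else (lookup v i ≟ᵇ i)

    separated : Fin n → Fin n → Bool
    separated i j = not (memᵇ i X ∧ memᵇ j X) ∨ (i ≟ᵇ j) ∨ not (lookup v i ≟ᵇ lookup v j)

    placed⁻ : ∀ i → T (placed i) → (i ∈ X → lookup v i ∈ Y) × (i ∉ X → lookup v i ≡ i)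
    placed⁻ i t with i ∈? X
    ... | yes i∈X = (λ _ → toWitness t) , (λ i∉X → contradiction i∈X i∉X)
    ... | no  i∉X = (λ i∈X → contradiction i∈X i∉X) , (λ _ → toWitness t)

    placed⁺ : IsDiagonal X Y v → ∀ i → T (placed i)
    placed⁺ d i with i ∈? X
    ... | yes i∈X = fromWitness (maps-into d i∈X)
    ... | no  i∉X = fromWitness (fixes-outside d i∉X)

    separated⁻ : ∀ i j → T (separated i j) → i ∈ X → j ∈ X → lookup v i ≡ lookup v j → i ≡ j
    separated⁻ i j t i∈X j∈X vi≡vj with i ∈? X | j ∈? X | i Fin.≟ j | lookup v i Fin.≟ lookup v j
    ... | _        | _        | yes i≡j | _       = i≡j
    ... | _        | _        | no  _   | no vi≢vj = contradiction vi≡vj vi≢vj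
    ... | no i∉X   | _        | no  _   | yes _    = contradiction i∈X i∉X
    ... | yes _    | no j∉X   | no  _   | yes _    = contradiction j∈X j∉X

    separated⁺ : IsDiagonal X Y v → ∀ i j → T (separated i j)
    separated⁺ d i j with i ∈? X | j ∈? X | i Fin.≟ j | lookup v i Fin.≟ lookup v j
    ... | no  _   | _       | _       | _       = _
    ... | yes _   | no  _   | _       | _       = _
    ... | yes _   | yes _   | yes _   | _       = _
    ... | yes _   | yes _   | no  _   | no  _   = _
    ... | yes i∈X | yes j∈X | no  i≢j | yes vi≡vj = i≢j (injective-on d i∈X j∈X vi≡vj)

  isDiagᵇ⇒IsDiagonal : T (isDiagᵇ X Y v) → IsDiagonal X Y v
  isDiagᵇ⇒IsDiagonal t = record
    { maps-into     = λ {i} → proj₁ (placed⁻ i (T-and-allFin⁻ placed (proj₁ t∧) i))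
    ; fixes-outside = λ {i} → proj₂ (placed⁻ i (T-and-allFin⁻ placed (proj₁ t∧) i))
    ; injective-on  = λ {i} {j} → separated⁻ i j (T-and-allFin²⁻ separated (proj₂ t∧) i j)
    }
    where t∧ = Equivalence.to T-∧ t

  IsDiagonal⇒isDiagᵇ : IsDiagonal X Y v → T (isDiagᵇ X Y v)
  IsDiagonal⇒isDiagᵇ d = Equivalence.from T-∧
    (T-and-allFin⁺ placed (placed⁺ d) , T-and-allFin²⁺ separated (separated⁺ d))

  isDiagᵇ-reflects : Reflects (IsDiagonal X Y v) (isDiagᵇ X Y v)
  isDiagᵇ-reflects = fromEquivalence isDiagᵇ⇒IsDiagonal IsDiagonal⇒isDiagᵇ

diagonal-exists : ∀ {n} k (X Y : Subset n) → ∣ X ∣ ≡ k → ∣ Y ∣ ≡ k → ∃[ v ] IsDiagonal X Y v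
diagonal-exists {n} zero X Y ∣X∣≡0 _ = Vec.allFin n , record
  { maps-into     = λ i∈X → contradiction i∈X (∣p∣≡0⇒x∉p ∣X∣≡0)
  ; fixes-outside = λ {i} _ → Vec.lookup-allFin i
  ; injective-on  = λ i∈X → contradiction i∈X (∣p∣≡0⇒x∉p ∣X∣≡0)
  }
diagonal-exists (suc k) X Y ∣X∣≡1+k ∣Y∣≡1+k =
  v′ [ x ]≔ y , record { maps-into = maps-into′ ; fixes-outside = fixes-outside′ ; injective-on = injective-on′ }
  where
  x = proj₁ (∣p∣≡suc⇒nonempty X ∣X∣≡1+k)
  y = proj₁ (∣p∣≡suc⇒nonempty Y ∣Y∣≡1+k)
  x∈X : x ∈ X
  x∈X = proj₂ (∣p∣≡suc⇒nonempty X ∣X∣≡1+k)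
  y∈Y : y ∈ Y
  y∈Y = proj₂ (∣p∣≡suc⇒nonempty Y ∣Y∣≡1+k)
  rest = diagonal-exists k (X - x) (Y - y)
           (suc-injective (trans (x∈p⇒1+∣p-x∣≡∣p∣ x∈X) ∣X∣≡1+k))
           (suc-injective (trans (x∈p⇒1+∣p-x∣≡∣p∣ y∈Y) ∣Y∣≡1+k))
  v′ = proj₁ rest
  d′ = proj₂ rest

  lookup-x : lookup (v′ [ x ]≔ y) x ≡ y
  lookup-x = Vec.lookup∘update x v′ y

  lookup-≢x : ∀ {i} → i ≢ x → lookup (v′ [ x ]≔ y) i ≡ lookup v′ i
  lookup-≢x i≢x = Vec.lookup∘update′ i≢x v′ y

  maps-into′ : ∀ {i} → i ∈ X → lookup (v′ [ x ]≔ y) i ∈ Y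
  maps-into′ {i} i∈X with i Fin.≟ x
  ... | yes refl = subst (_∈ Y) (sym lookup-x) y∈Y
  ... | no  i≢x  = subst (_∈ Y) (sym (lookup-≢x i≢x))
                     (p─q⊆p Y ⁅ y ⁆ (maps-into d′ (x∈p∧x≢y⇒x∈p-y i∈X i≢x)))

  fixes-outside′ : ∀ {i} → i ∉ X → lookup (v′ [ x ]≔ y) i ≡ i
  fixes-outside′ i∉X = trans (lookup-≢x i≢x) (fixes-outside d′ (i∉X ∘ p─q⊆p X ⁅ x ⁆))
    where i≢x = λ i≡x → i∉X (subst (_∈ X) (sym i≡x) x∈X)

  ≢y : ∀ {j} → j ∈ X → j ≢ x → lookup (v′ [ x ]≔ y) j ≢ y
  ≢y j∈X j≢x = subst (_≢ y) (sym (lookup-≢x j≢x))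
                 (x∈p-y⇒x≢y (maps-into d′ (x∈p∧x≢y⇒x∈p-y j∈X j≢x)))

  injective-on′ : ∀ {i j} → i ∈ X → j ∈ X →
                  lookup (v′ [ x ]≔ y) i ≡ lookup (v′ [ x ]≔ y) j → i ≡ j
  injective-on′ {i} {j} i∈X j∈X vi≡vj with i Fin.≟ x | j Fin.≟ x
  ... | yes refl | yes refl = refl
  ... | yes refl | no  j≢x  = contradiction (trans (sym vi≡vj) lookup-x) (≢y j∈X j≢x)
  ... | no  i≢x  | yes refl = contradiction (trans vi≡vj lookup-x) (≢y i∈X i≢x)
  ... | no  i≢x  | no  j≢x  = injective-on d′ (x∈p∧x≢y⇒x∈p-y i∈X i≢x) (x∈p∧x≢y⇒x∈p-y j∈X j≢x)
                                (trans (sym (lookup-≢x i≢x)) (trans vi≡vj (lookup-≢x j≢x)))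

-- Transpositions of rows and columns

module _ {n : ℕ} (i j : Fin n) where

  transpose-ˡ : transpose i j i ≡ j
  transpose-ˡ with i Fin.≟ i
  ... | yes _   = refl
  ... | no  i≢i = contradiction refl i≢i

  transpose-ʳ : transpose i j j ≡ i
  transpose-ʳ with j Fin.≟ i
  ... | yes j≡i = j≡i
  ... | no  _ with j Fin.≟ j
  ...   | yes _   = refl
  ...   | no  j≢j = contradiction refl j≢j

  transpose-other : ∀ {k} → k ≢ i → k ≢ j → transpose i j k ≡ k
  transpose-other {k} k≢i k≢j with k Fin.≟ i
  ... | yes k≡i = contradiction k≡i k≢i
  ... | no  _ with k Fin.≟ j
  ...   | yes k≡j = contradiction k≡j k≢j
  ...   | no  _   = refl

  transpose-injective : ∀ {k l} → transpose i j k ≡ transpose i j l → k ≡ l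
  transpose-injective {k} {l} eq =
    trans (sym (transpose-inverse j i)) (trans (cong (transpose j i) eq) (transpose-inverse j i))

  δᶠ-transpose : ∀ x y → δᶠ (transpose i j x) (transpose i j y) ≡ δᶠ x y
  δᶠ-transpose x y =
    δ-cong-⇔ Fin._≟_ {transpose i j x} {transpose i j y} {x} {y} transpose-injective (cong (transpose i j))

  transpose-∈ : ∀ {Z : Subset n} {k} → i ∈ Z → j ∈ Z → k ∈ Z → transpose i j k ∈ Z
  transpose-∈ {k = k} i∈Z j∈Z k∈Z with k Fin.≟ i
  ... | yes _ = j∈Z
  ... | no  _ with k Fin.≟ j
  ...   | yes _ = i∈Z
  ...   | no  _ = k∈Z

swapRows : Fin n → Fin n → Assignment n → Assignment n
swapRows i k σ = Vec.tabulate (lookup σ ∘ transpose i k)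

swapCols : Subset n → Fin n → Fin n → Assignment n → Assignment n
swapCols X a b σ = Vec.tabulate (λ p → if memᵇ p X then transpose a b (lookup σ p) else lookup σ p)

module _ {n : ℕ} where

  lookup-swapRows : ∀ i k (σ : Assignment n) p → lookup (swapRows i k σ) p ≡ lookup σ (transpose i k p)
  lookup-swapRows i k σ = Vec.lookup∘tabulate (lookup σ ∘ transpose i k)

  lookup-swapCols-∈ : ∀ {X} a b (σ : Assignment n) {p} → p ∈ X →
                      lookup (swapCols X a b σ) p ≡ transpose a b (lookup σ p)
  lookup-swapCols-∈ {X} a b σ {p} p∈X = trans (Vec.lookup∘tabulate _ p)
    (cong (λ t → if t then transpose a b (lookup σ p) else lookup σ p) (∈⇒memᵇ p∈X))

  lookup-swapCols-∉ : ∀ {X} a b (σ : Assignment n) {p} → p ∉ X →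
                      lookup (swapCols X a b σ) p ≡ lookup σ p
  lookup-swapCols-∉ {X} a b σ {p} p∉X = trans (Vec.lookup∘tabulate _ p)
    (cong (λ t → if t then transpose a b (lookup σ p) else lookup σ p) (∉⇒memᵇ p∉X))

  swapRows-inverse : ∀ i k (σ : Assignment n) → swapRows i k (swapRows k i σ) ≡ σ
  swapRows-inverse i k σ = trans (Vec.tabulate-cong λ p →
      trans (lookup-swapRows k i σ (transpose i k p)) (cong (lookup σ) (transpose-inverse k i)))
    (Vec.tabulate∘lookup σ)

  swapCols-inverse : ∀ X a b (σ : Assignment n) → swapCols X a b (swapCols X b a σ) ≡ σ
  swapCols-inverse X a b σ = trans (Vec.tabulate-cong back) (Vec.tabulate∘lookup σ)
    where
    back : ∀ p → (if memᵇ p X then transpose a b (lookup (swapCols X b a σ) p) else lookup (swapCols X b a σ) p)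
               ≡ lookup σ p
    back p with p ∈? X
    ... | yes p∈X = trans (cong (transpose a b) (lookup-swapCols-∈ b a σ p∈X)) (transpose-inverse a b)
    ... | no  p∉X = lookup-swapCols-∉ b a σ p∉X

  module _ {X Y : Subset n} where

    swapRows-IsDiagonal : ∀ {i k} → i ∈ X → k ∈ X → ∀ {σ} → IsDiagonal X Y σ → IsDiagonal X Y (swapRows i k σ)
    swapRows-IsDiagonal {i} {k} i∈X k∈X {σ} d = record
      { maps-into     = λ {p} p∈X → subst (_∈ Y) (sym (lookup-swapRows i k σ p))
                                      (maps-into d (transpose-∈ i k i∈X k∈X p∈X))
      ; fixes-outside = λ {p} p∉X → trans (lookup-swapRows i k σ p)
                                      (trans (cong (lookup σ) (transpose-other i k (p≢ p∉X i∈X) (p≢ p∉X k∈X)))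
                                             (fixes-outside d p∉X))
      ; injective-on  = λ {p} {q} p∈X q∈X σp≡σq → transpose-injective i k
          (injective-on d (transpose-∈ i k i∈X k∈X p∈X) (transpose-∈ i k i∈X k∈X q∈X)
            (trans (sym (lookup-swapRows i k σ p)) (trans σp≡σq (lookup-swapRows i k σ q))))
      }
      where
      p≢ : ∀ {p j} → p ∉ X → j ∈ X → p ≢ j
      p≢ p∉X j∈X refl = p∉X j∈X

    swapCols-IsDiagonal : ∀ {a b} → a ∈ Y → b ∈ Y → ∀ {σ} → IsDiagonal X Y σ → IsDiagonal X Y (swapCols X a b σ)
    swapCols-IsDiagonal {a} {b} a∈Y b∈Y {σ} d = record
      { maps-into     = λ p∈X → subst (_∈ Y) (sym (lookup-swapCols-∈ a b σ p∈X))
                                  (transpose-∈ a b a∈Y b∈Y (maps-into d p∈X))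
      ; fixes-outside = λ p∉X → trans (lookup-swapCols-∉ a b σ p∉X) (fixes-outside d p∉X)
      ; injective-on  = λ p∈X q∈X σp≡σq → injective-on d p∈X q∈X (transpose-injective a b
          (trans (sym (lookup-swapCols-∈ a b σ p∈X)) (trans σp≡σq (lookup-swapCols-∈ a b σ q∈X))))
      }

    isDiagᵇ-invariant : (φ ψ : Assignment n → Assignment n) → (∀ σ → ψ (φ σ) ≡ σ) →
      (∀ {σ} → IsDiagonal X Y σ → IsDiagonal X Y (φ σ)) →
      (∀ {σ} → IsDiagonal X Y σ → IsDiagonal X Y (ψ σ)) →
      ∀ σ → isDiagᵇ X Y (φ σ) ≡ isDiagᵇ X Y σ
    isDiagᵇ-invariant φ ψ ψφ φ-pres ψ-pres σ = det
      (fromEquivalence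
        (λ t → subst (IsDiagonal X Y) (ψφ σ) (ψ-pres (isDiagᵇ⇒IsDiagonal X Y (φ σ) t)))
        (λ d → IsDiagonal⇒isDiagᵇ X Y (φ σ) (φ-pres d)))
      (isDiagᵇ-reflects X Y σ)

    isDiagᵇ-swapRows : ∀ {i k} → i ∈ X → k ∈ X → ∀ σ → isDiagᵇ X Y (swapRows i k σ) ≡ isDiagᵇ X Y σ
    isDiagᵇ-swapRows {i} {k} i∈X k∈X = isDiagᵇ-invariant (swapRows i k) (swapRows k i) (swapRows-inverse k i)
      (swapRows-IsDiagonal i∈X k∈X) (swapRows-IsDiagonal k∈X i∈X)

    isDiagᵇ-swapCols : ∀ {a b} → a ∈ Y → b ∈ Y → ∀ σ → isDiagᵇ X Y (swapCols X a b σ) ≡ isDiagᵇ X Y σ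
    isDiagᵇ-swapCols {a} {b} a∈Y b∈Y = isDiagᵇ-invariant (swapCols X a b) (swapCols X b a) (swapCols-inverse X b a)
      (swapCols-IsDiagonal a∈Y b∈Y) (swapCols-IsDiagonal b∈Y a∈Y)

-- Counting diagonals

module Diagonals {n : ℕ} (X Y : Subset n) (large : Fin n → Fin n → Bool) where

  𝒜 : List (Assignment n)
  𝒜 = allVecs n n

  diag : Assignment n → ℕ
  diag σ = 𝟙 (isDiagᵇ X Y σ)

  good : Assignment n → Bool
  good = isGoodᵇ large X

  badDiag : Assignment n → ℕ
  badDiag σ = diag σ * 𝟙 (not (good σ))

  #diagonals #bad : ℕ
  #diagonals = ∑ diag 𝒜
  #bad       = ∑ badDiag 𝒜

  largeInRow : Assignment n → Fin n → Bool
  largeInRow σ p = memᵇ p X ∧ large p (lookup σ p)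

  ∑-𝒜-∘-inverse : (φ ψ : Assignment n → Assignment n) → (∀ σ → ψ (φ σ) ≡ σ) → (∀ σ → φ (ψ σ) ≡ σ) →
                  (f : Assignment n → ℕ) → ∑ (f ∘ φ) 𝒜 ≡ ∑ f 𝒜
  ∑-𝒜-∘-inverse = ∑-∘-inverse (Vec.≡-dec Fin._≟_) 𝒜 (allVecs-once n n)

  module Pivot {i k c j : Fin n} (i∈X : i ∈ X) (k∈X : k ∈ X) (c∈Y : c ∈ Y) (j∈Y : j ∈ Y)
               (ic-large : large i c ≡ true) (ij-small : large i j ≡ false) (kc-small : large k c ≡ false) where

    i≢k : i ≢ k
    i≢k refl = case trans (sym ic-large) kc-small of λ ()

    c≢j : c ≢ j
    c≢j refl = case trans (sym ic-large) ij-small of λ ()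

    at : Assignment n → Fin n → Fin n → ℕ
    at σ u v = δᶠ (lookup σ i) u * δᶠ (lookup σ k) v

    #at : (Assignment n → ℕ) → Fin n → Fin n → ℕ
    #at h u v = ∑ (λ σ → h σ * at σ u v) 𝒜

    ∑-by-rows-i-k : (h : Assignment n → ℕ) → ∑ h 𝒜 ≡ ∑² (#at h)
    ∑-by-rows-i-k h = begin
      ∑ h 𝒜                                            ≡⟨ ∑-cong 𝒜 (λ σ → sym (split σ)) ⟩
      ∑ (λ σ → ∑² (λ u v → h σ * at σ u v)) 𝒜         ≡⟨ ∑-comm _ 𝒜 (allFin n) ⟩
      ∑ (λ u → ∑ (λ σ → ∑ (λ v → h σ * at σ u v) (allFin n)) 𝒜) (allFin n)
                                                        ≡⟨ ∑-cong (allFin n) (λ u → ∑-comm _ 𝒜 (allFin n)) ⟩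
      ∑² (#at h)                                        ∎
      where
      open ≡-Reasoning
      rearrange : ∀ a b c → a * (b * c) ≡ b * (c * a)
      rearrange = solve-∀
      split : ∀ σ → ∑² (λ u v → h σ * at σ u v) ≡ h σ
      split σ = begin
        ∑² (λ u v → h σ * (δᶠ (lookup σ i) u * δᶠ (lookup σ k) v))
          ≡⟨ ∑²-cong (λ u v → rearrange (h σ) (δᶠ (lookup σ i) u) (δᶠ (lookup σ k) v)) ⟩
        ∑² (λ u v → δᶠ (lookup σ i) u * (δᶠ (lookup σ k) v * h σ))
          ≡⟨ ∑²-* (δᶠ (lookup σ i)) (δᶠ (lookup σ k)) (h σ) ⟩
        ∑ (δᶠ (lookup σ i)) (allFin n) * (∑ (δᶠ (lookup σ k)) (allFin n) * h σ)
          ≡⟨ cong₂ (λ a b → a * (b * h σ)) (∑-δᶠ-one (lookup σ i)) (∑-δᶠ-one (lookup σ k)) ⟩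
        1 * (1 * h σ)
          ≡⟨ trans (*-identityˡ (1 * h σ)) (*-identityˡ (h σ)) ⟩
        h σ ∎

    #diag-at : Fin n → Fin n → ℕ
    #diag-at = #at diag

    #diag-at-≡0 : ∀ {u v} → (∀ {σ} → IsDiagonal X Y σ → lookup σ i ≡ u → lookup σ k ≡ v → ⊥) → #diag-at u v ≡ 0
    #diag-at-≡0 {u} {v} impossible = trans (∑-cong 𝒜 vanish) (∑-zero 𝒜)
      where
      vanish : ∀ σ → diag σ * at σ u v ≡ 0
      vanish σ with isDiagᵇ X Y σ | isDiagᵇ-reflects X Y σ | lookup σ i Fin.≟ u | lookup σ k Fin.≟ v
      ... | false | _     | _     | _     = refl
      ... | true  | _     | no _  | _     = refl
      ... | true  | _     | yes _ | no _  = refl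
      ... | true  | ofʸ d | yes p | yes q = ⊥-elim (impossible d p q)

    #diag-at-∉ˡ : ∀ {u} v → u ∉ Y → #diag-at u v ≡ 0
    #diag-at-∉ˡ v u∉Y = #diag-at-≡0 (λ d σi≡u _ → u∉Y (subst (_∈ Y) σi≡u (maps-into d i∈X)))

    #diag-at-∉ʳ : ∀ u {v} → v ∉ Y → #diag-at u v ≡ 0
    #diag-at-∉ʳ u v∉Y = #diag-at-≡0 (λ d _ σk≡v → v∉Y (subst (_∈ Y) σk≡v (maps-into d k∈X)))

    #diag-at-same : ∀ u → #diag-at u u ≡ 0
    #diag-at-same u = #diag-at-≡0 (λ d σi≡u σk≡u → i≢k (injective-on d i∈X k∈X (trans σi≡u (sym σk≡u))))

    #diag-at-swapCols : ∀ {a b} → a ∈ Y → b ∈ Y → ∀ u v →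
                        #diag-at (transpose a b u) (transpose a b v) ≡ #diag-at u v
    #diag-at-swapCols {a} {b} a∈Y b∈Y u v = begin
      #diag-at (τ u) (τ v)                            ≡⟨ ∑-𝒜-∘-inverse ψ ψ⁻¹ (swapCols-inverse X b a) (swapCols-inverse X a b) _ ⟨
      ∑ (λ σ → diag (ψ σ) * at (ψ σ) (τ u) (τ v)) 𝒜  ≡⟨ ∑-cong 𝒜 swapped ⟩
      #diag-at u v                                    ∎
      where
      open ≡-Reasoning
      τ = transpose a b
      ψ = swapCols X a b
      ψ⁻¹ = swapCols X b a
      δᶠ-ψ : ∀ σ {p} → p ∈ X → ∀ w → δᶠ (lookup (ψ σ) p) (τ w) ≡ δᶠ (lookup σ p) w
      δᶠ-ψ σ {p} p∈X w = trans (cong (λ x → δᶠ x (τ w)) (lookup-swapCols-∈ a b σ p∈X)) (δᶠ-transpose a b (lookup σ p) w)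
      swapped : ∀ σ → diag (ψ σ) * at (ψ σ) (τ u) (τ v) ≡ diag σ * at σ u v
      swapped σ = cong₂ _*_ (cong 𝟙 (isDiagᵇ-swapCols a∈Y b∈Y σ)) (cong₂ _*_ (δᶠ-ψ σ i∈X u) (δᶠ-ψ σ k∈X v))

    e : ℕ
    e = #diag-at c j

    #diag-at-const : ∀ {u v} → u ∈ Y → v ∈ Y → u ≢ v → #diag-at u v ≡ e
    #diag-at-const {u} {v} u∈Y v∈Y u≢v = begin
      #diag-at u v                       ≡⟨ #diag-at-swapCols u∈Y c∈Y u v ⟨
      #diag-at (τ₁ u) v′                 ≡⟨ cong (λ w → #diag-at w v′) (transpose-ˡ u c) ⟩
      #diag-at c v′                      ≡⟨ #diag-at-swapCols v′∈Y j∈Y c v′ ⟨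
      #diag-at (τ₂ c) (τ₂ v′)            ≡⟨ cong₂ #diag-at (transpose-other v′ j (v′≢c ∘ sym) c≢j) (transpose-ˡ v′ j) ⟩
      #diag-at c j                       ∎
      where
      open ≡-Reasoning
      τ₁ = transpose u c
      v′ = τ₁ v
      τ₂ = transpose v′ j
      v′∈Y : v′ ∈ Y
      v′∈Y = transpose-∈ u c u∈Y c∈Y v∈Y
      v′≢c : v′ ≢ c
      v′≢c v′≡c = u≢v (sym (transpose-injective u c (trans v′≡c (sym (transpose-ˡ u c)))))

    #diagonals≤ : #diagonals ≤ ∣ Y ∣ * (∣ Y ∣ * e)
    #diagonals≤ = begin
      #diagonals                                         ≡⟨ ∑-by-rows-i-k diag ⟩
      ∑² #diag-at                                        ≤⟨ ∑²-mono-≤ bound ⟩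
      ∑² (λ u v → 𝟙 (memᵇ u Y) * (𝟙 (memᵇ v Y) * e))   ≡⟨ ∑²-* (λ u → 𝟙 (memᵇ u Y)) (λ v → 𝟙 (memᵇ v Y)) e ⟩
      ∑ (λ u → 𝟙 (memᵇ u Y)) (allFin n) * (∑ (λ v → 𝟙 (memᵇ v Y)) (allFin n) * e)
                                                         ≡⟨ cong (λ m → m * (m * e)) (∑-memᵇ≡∣∣ Y) ⟩
      ∣ Y ∣ * (∣ Y ∣ * e)                                ∎
      where
      open ≤-Reasoning
      bound : ∀ u v → #diag-at u v ≤ 𝟙 (memᵇ u Y) * (𝟙 (memᵇ v Y) * e)
      bound u v with u ∈? Y | v ∈? Y
      ... | no  u∉Y | _       = ≤-reflexive (#diag-at-∉ˡ v u∉Y)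
      ... | yes _   | no  v∉Y = ≤-reflexive (#diag-at-∉ʳ u v∉Y)
      ... | yes u∈Y | yes v∈Y with u Fin.≟ v
      ...   | yes refl = subst (_≤ 1 * (1 * e)) (sym (#diag-at-same u)) z≤n
      ...   | no  u≢v  = ≤-reflexive (trans (#diag-at-const u∈Y v∈Y u≢v)
                                            (sym (trans (*-identityˡ (1 * e)) (*-identityˡ e))))

    separates : Fin n → Bool
    separates u = large i u ∧ not (large k u)

    ρ : Assignment n → Assignment n
    ρ = swapRows i k

    lookup-ρ-i : ∀ σ → lookup (ρ σ) i ≡ lookup σ k
    lookup-ρ-i σ = trans (lookup-swapRows i k σ i) (cong (lookup σ) (transpose-ˡ i k))

    lookup-ρ-k : ∀ σ → lookup (ρ σ) k ≡ lookup σ i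
    lookup-ρ-k σ = trans (lookup-swapRows i k σ k) (cong (lookup σ) (transpose-ʳ i k))

    exchange-bad : ∀ σ → separates (lookup σ i) ≡ true → separates (lookup σ k) ≡ false →
                   1 ≤ 𝟙 (not (good σ)) + 𝟙 (not (good (ρ σ)))
    exchange-bad σ sep-u sep-v with good σ in good-σ | good (ρ σ) in good-ρσ
    ... | false | _     = s≤s z≤n
    ... | true  | false = s≤s z≤n
    -- Exchanging σ(i) and σ(k) only affects rows i and k; if both diagonals had exactly
    -- one large entry, then (i,v) would be large and (k,v) small, i.e. separates v.
    ... | true  | true  = ⊥-elim (counts-contradict (Q i) (Q k) (P i) (P k) counts Pi≡true Qk≡false Qi∧¬Pk≡false)
      where
      u = lookup σ i
      v = lookup σ k
      P Q : Fin n → Bool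
      P = largeInRow σ
      Q = largeInRow (ρ σ)
      single : ∀ τ → good τ ≡ true → countᵇ (largeInRow τ) (allFin n) ≡ 1
      single τ eq = ≡ᵇ⇒≡ _ 1 (Equivalence.from T-≡ eq)
      agree : ∀ p → p ≢ i → p ≢ k → P p ≡ Q p
      agree p p≢i p≢k = cong (λ w → memᵇ p X ∧ large p w)
        (sym (trans (lookup-swapRows i k σ p) (cong (lookup σ) (transpose-other i k p≢i p≢k))))
      counts : 1 + (𝟙 (Q i) + 𝟙 (Q k)) ≡ 1 + (𝟙 (P i) + 𝟙 (P k))
      counts = trans (cong (_+ (𝟙 (Q i) + 𝟙 (Q k))) (sym (single σ good-σ)))
                 (trans (count-agree-off-two i≢k P Q agree) (cong (_+ (𝟙 (P i) + 𝟙 (P k))) (single (ρ σ) good-ρσ)))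
      memᵇ-i = ∈⇒memᵇ i∈X
      memᵇ-k = ∈⇒memᵇ k∈X
      Pi≡true : P i ≡ true
      Pi≡true = trans (cong (_∧ large i u) memᵇ-i) (∧-conicalˡ _ _ sep-u)
      Qk≡false : Q k ≡ false
      Qk≡false = trans (cong₂ (λ b w → b ∧ large k w) memᵇ-k (lookup-ρ-k σ)) (not-true⇒false (∧-conicalʳ _ _ sep-u))
        where not-true⇒false : ∀ {b} → not b ≡ true → b ≡ false
              not-true⇒false {false} _ = refl
      Qi∧¬Pk≡false : Q i ∧ not (P k) ≡ false
      Qi∧¬Pk≡false = trans (cong₂ (λ Qi Pk → Qi ∧ not Pk)
                              (cong₂ (λ b w → b ∧ large i w) memᵇ-i (lookup-ρ-i σ)) (cong (_∧ large k v) memᵇ-k))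
                            sep-v
      counts-contradict : ∀ a b c d → 1 + (𝟙 a + 𝟙 b) ≡ 1 + (𝟙 c + 𝟙 d) → c ≡ true → b ≡ false → a ∧ not d ≡ false → ⊥
      counts-contradict true  false true  false _  _ _  ()
      counts-contradict true  false true  true  () _ _  _
      counts-contradict false false true  _     () _ _  _
      counts-contradict _     true  _     _     _  _ () _
      counts-contradict _     false false _     _  () _ _

    #bad-at : Fin n → Fin n → ℕ
    #bad-at = #at badDiag

    #bad-at-flip : ∀ u v → #bad-at v u ≡ ∑ (λ σ → (diag σ * 𝟙 (not (good (ρ σ)))) * at σ u v) 𝒜
    #bad-at-flip u v = trans (sym (∑-𝒜-∘-inverse ρ (swapRows k i) (swapRows-inverse k i) (swapRows-inverse i k) _))
                             (∑-cong 𝒜 flipped)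
      where
      flipped : ∀ σ → badDiag (ρ σ) * at (ρ σ) v u ≡ (diag σ * 𝟙 (not (good (ρ σ)))) * at σ u v
      flipped σ = cong₂ (λ d a → (d * 𝟙 (not (good (ρ σ)))) * a)
        (cong 𝟙 (isDiagᵇ-swapRows i∈X k∈X σ))
        (trans (cong₂ (λ x y → δᶠ x v * δᶠ y u) (lookup-ρ-i σ) (lookup-ρ-k σ)) (*-comm (δᶠ (lookup σ k) v) (δᶠ (lookup σ i) u)))

    #diag-at≤ : ∀ {u v} → separates u ≡ true → separates v ≡ false → #diag-at u v ≤ #bad-at u v + #bad-at v u
    #diag-at≤ {u} {v} sep-u sep-v = begin
      #diag-at u v
        ≤⟨ ∑-mono-≤ 𝒜 one-bad ⟩
      ∑ (λ σ → badDiag σ * at σ u v + (diag σ * 𝟙 (not (good (ρ σ)))) * at σ u v) 𝒜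
        ≡⟨ ∑-+ _ _ 𝒜 ⟩
      #bad-at u v + ∑ (λ σ → (diag σ * 𝟙 (not (good (ρ σ)))) * at σ u v) 𝒜
        ≡⟨ cong (#bad-at u v +_) (#bad-at-flip u v) ⟨
      #bad-at u v + #bad-at v u ∎
      where
      open ≤-Reasoning
      one-bad : ∀ σ → diag σ * at σ u v ≤ badDiag σ * at σ u v + (diag σ * 𝟙 (not (good (ρ σ)))) * at σ u v
      one-bad σ with isDiagᵇ X Y σ | lookup σ i Fin.≟ u | lookup σ k Fin.≟ v
      ... | false | _        | _        = z≤n
      ... | true  | no  _    | _        = z≤n
      ... | true  | yes _    | no  _    = z≤n
      ... | true  | yes refl | yes refl =
        subst (1 ≤_) (sym (normalise (𝟙 (not (good σ))) (𝟙 (not (good (ρ σ)))))) (exchange-bad σ sep-u sep-v)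
        where
        normalise : ∀ a b → (1 * a) * (1 * 1) + (1 * b) * (1 * 1) ≡ a + b
        normalise = solve-∀

    inU inV : Fin n → Bool
    inU u = memᵇ u Y ∧ separates u
    inV u = memᵇ u Y ∧ not (separates u)

    inU⇒ : ∀ {u} → inU u ≡ true → u ∈ Y × separates u ≡ true
    inU⇒ {u} eq = memᵇ⇒∈ (∧-conicalˡ _ _ eq) , ∧-conicalʳ (memᵇ u Y) _ eq

    inV⇒ : ∀ {v} → inV v ≡ true → v ∈ Y × separates v ≡ false
    inV⇒ {v} eq = memᵇ⇒∈ (∧-conicalˡ _ _ eq) , not-injective (∧-conicalʳ (memᵇ v Y) _ eq)

    -- Since U ∩ V = ∅, no index pair (u,v) lies in both U × V and V × U, so no bad
    -- diagonal is counted twice.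
    ∣U∣*∣V∣*e≤#bad : ∑ (𝟙 ∘ inU) (allFin n) * (∑ (𝟙 ∘ inV) (allFin n) * e) ≤ #bad
    ∣U∣*∣V∣*e≤#bad = begin
      ∑ (𝟙 ∘ inU) (allFin n) * (∑ (𝟙 ∘ inV) (allFin n) * e) ≡⟨ ∑²-* (𝟙 ∘ inU) (𝟙 ∘ inV) e ⟨
      ∑² (λ u v → 𝟙 (inU u) * (𝟙 (inV v) * e))               ≤⟨ ∑²-mono-≤ via-pairs ⟩
      ∑² (λ u v → badUV u v + badVU v u)                     ≡⟨ ∑²-+ badUV (λ u v → badVU v u) ⟩
      ∑² badUV + ∑² (λ u v → badVU v u)                      ≡⟨ cong (∑² badUV +_) (∑²-flip badVU) ⟩
      ∑² badUV + ∑² badVU                                    ≡⟨ ∑²-+ badUV badVU ⟨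
      ∑² (λ u v → badUV u v + badVU u v)                     ≤⟨ ∑²-mono-≤ U∩V≡∅⇒≤ ⟩
      ∑² #bad-at                                             ≡⟨ ∑-by-rows-i-k badDiag ⟨
      #bad                                                   ∎
      where
      open ≤-Reasoning
      badUV badVU : Fin n → Fin n → ℕ
      badUV u v = 𝟙 (inU u) * (𝟙 (inV v) * #bad-at u v)
      badVU u v = 𝟙 (inU v) * (𝟙 (inV u) * #bad-at u v)
      U∩V≡∅ : ∀ u → inU u ∧ inV u ≡ false
      U∩V≡∅ u with memᵇ u Y | separates u
      ... | true  | true  = refl
      ... | true  | false = refl
      ... | false | _     = refl
      U∩V≡∅⇒≤ : ∀ u v → badUV u v + badVU u v ≤ #bad-at u v
      U∩V≡∅⇒≤ u v = 𝟙-disjoint-≤ (inU u) (inV v) (inU v) (inV u) (#bad-at u v) (U∩V≡∅ u)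
      via-pairs : ∀ u v → 𝟙 (inU u) * (𝟙 (inV v) * e) ≤ badUV u v + badVU v u
      via-pairs u v with inU u in u∈U | inV v in v∈V
      ... | false | _     = z≤n
      ... | true  | false = z≤n
      ... | true  | true  = begin
        1 * (1 * e)                                     ≡⟨ 1*1*x≡x e ⟩
        e                                               ≡⟨ #diag-at-const u∈Y v∈Y u≢v ⟨
        #diag-at u v                                    ≤⟨ #diag-at≤ sep-u sep-v ⟩
        #bad-at u v + #bad-at v u                       ≡⟨ cong₂ _+_ (1*1*x≡x (#bad-at u v)) (1*1*x≡x (#bad-at v u)) ⟨
        1 * (1 * #bad-at u v) + 1 * (1 * #bad-at v u)   ∎
        where
        u∈Y = proj₁ (inU⇒ u∈U)
        sep-u = proj₂ (inU⇒ u∈U)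
        v∈Y = proj₁ (inV⇒ v∈V)
        sep-v = proj₂ (inV⇒ v∈V)
        u≢v : u ≢ v
        u≢v refl = case trans (sym sep-u) sep-v of λ ()

    ∣U∣+∣V∣≡∣Y∣ : ∑ (𝟙 ∘ inU) (allFin n) + ∑ (𝟙 ∘ inV) (allFin n) ≡ ∣ Y ∣
    ∣U∣+∣V∣≡∣Y∣ = trans (sym (∑-+ (𝟙 ∘ inU) (𝟙 ∘ inV) (allFin n)))
                        (trans (∑-cong (allFin n) (λ u → split (memᵇ u Y) (separates u))) (∑-memᵇ≡∣∣ Y))
      where
      split : ∀ a s → 𝟙 (a ∧ s) + 𝟙 (a ∧ not s) ≡ 𝟙 a
      split true  true  = refl
      split true  false = refl
      split false _     = refl

    c∈U : inU c ≡ true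
    c∈U rewrite ∈⇒memᵇ c∈Y | ic-large | kc-small = refl

    j∈V : inV j ≡ true
    j∈V rewrite ∈⇒memᵇ j∈Y | ij-small = refl

    1≤∣U∣ : 1 ≤ ∑ (𝟙 ∘ inU) (allFin n)
    1≤∣U∣ = subst (λ b → 𝟙 b ≤ ∑ (𝟙 ∘ inU) (allFin n)) c∈U (≤-∑ Fin._≟_ (allFin n) (allFin-once n) (𝟙 ∘ inU) c)

    1≤∣V∣ : 1 ≤ ∑ (𝟙 ∘ inV) (allFin n)
    1≤∣V∣ = subst (λ b → 𝟙 b ≤ ∑ (𝟙 ∘ inV) (allFin n)) j∈V (≤-∑ Fin._≟_ (allFin n) (allFin-once n) (𝟙 ∘ inV) j)

    #diagonals≤4∣Y∣#bad : #diagonals ≤ 4 * ∣ Y ∣ * #bad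
    #diagonals≤4∣Y∣#bad = begin
      #diagonals                  ≤⟨ #diagonals≤ ⟩
      ∣ Y ∣ * (∣ Y ∣ * e)         ≡⟨ cong (λ m → ∣ Y ∣ * (m * e)) ∣U∣+∣V∣≡∣Y∣ ⟨
      ∣ Y ∣ * ((a + b) * e)       ≤⟨ *-monoʳ-≤ ∣ Y ∣ (*-monoˡ-≤ e (m+n≤4mn 1≤∣U∣ 1≤∣V∣)) ⟩
      ∣ Y ∣ * (4 * (a * b) * e)   ≡⟨ rearrange ∣ Y ∣ a b e ⟩
      4 * ∣ Y ∣ * (a * (b * e))   ≤⟨ *-monoʳ-≤ (4 * ∣ Y ∣) ∣U∣*∣V∣*e≤#bad ⟩
      4 * ∣ Y ∣ * #bad            ∎
      where
      open ≤-Reasoning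
      a = ∑ (𝟙 ∘ inU) (allFin n)
      b = ∑ (𝟙 ∘ inV) (allFin n)
      rearrange : ∀ y a b e → y * (4 * (a * b) * e) ≡ 4 * y * (a * (b * e))
      rearrange = solve-∀

  no-large⇒#diagonals≤#bad : (∀ {p q} → p ∈ X → q ∈ Y → large p q ≡ false) → #diagonals ≤ #bad
  no-large⇒#diagonals≤#bad none = ∑-mono-≤ 𝒜 all-bad
    where
    all-bad : ∀ σ → diag σ ≤ badDiag σ
    all-bad σ with isDiagᵇ X Y σ | isDiagᵇ-reflects X Y σ
    ... | false | _     = z≤n
    ... | true  | ofʸ d = subst (λ m → 1 ≤ 1 * 𝟙 (not (m ≡ᵇ 1))) (sym none-large) (s≤s z≤n)
      where
      small : ∀ p → largeInRow σ p ≡ false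
      small p with p ∈? X
      ... | yes p∈X = none p∈X (maps-into d p∈X)
      ... | no  _   = refl
      none-large : countᵇ (largeInRow σ) (allFin n) ≡ 0
      none-large = trans (countᵇ≡∑𝟙 (largeInRow σ) (allFin n))
                         (trans (∑-cong (allFin n) (cong 𝟙 ∘ small)) (∑-zero (allFin n)))

  no-strong-line⇒#diagonals≤4∣Y∣#bad : 1 ≤ ∣ Y ∣ → ¬ HasZeroStrongLine (λ p q → large p q ≡ true) X Y →
                                        #diagonals ≤ 4 * ∣ Y ∣ * #bad
  no-strong-line⇒#diagonals≤4∣Y∣#bad 1≤∣Y∣ no-line
    with any? (λ i → any? (λ c → i ∈? X ×-dec c ∈? Y ×-dec large i c Bool.≟ true))
  ... | yes (i , c , i∈X , c∈Y , ic-large)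
    with ¬all⇒∃false Y (large i) (λ row → no-line (inj₁ (i , i∈X , row)))
       | ¬all⇒∃false X (λ p → large p c) (λ col → no-line (inj₂ (c , c∈Y , col)))
  ...   | j , j∈Y , ij-small | k , k∈X , kc-small =
    Pivot.#diagonals≤4∣Y∣#bad i∈X k∈X c∈Y j∈Y ic-large ij-small kc-small
  no-strong-line⇒#diagonals≤4∣Y∣#bad 1≤∣Y∣ no-line | no no-large = begin
    #diagonals           ≤⟨ no-large⇒#diagonals≤#bad none ⟩
    #bad                 ≡⟨ *-identityˡ #bad ⟨
    1 * #bad             ≤⟨ *-monoˡ-≤ #bad (≤-trans 1≤∣Y∣ (m≤n*m ∣ Y ∣ 4)) ⟩
    4 * ∣ Y ∣ * #bad     ∎
    where
    open ≤-Reasoning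
    none : ∀ {p q} → p ∈ X → q ∈ Y → large p q ≡ false
    none {p} {q} p∈X q∈Y with large p q in eq
    ... | true  = contradiction (p , q , p∈X , q∈Y , eq) no-large
    ... | false = refl

  1≤#diagonals : ∣ X ∣ ≡ ∣ Y ∣ → 1 ≤ #diagonals
  1≤#diagonals ∣X∣≡∣Y∣ =
    subst (λ b → 𝟙 b ≤ #diagonals) (Equivalence.to T-≡ (IsDiagonal⇒isDiagᵇ X Y v d))
      (≤-∑ (Vec.≡-dec Fin._≟_) 𝒜 (allVecs-once n n) diag v)
    where
    v = proj₁ (diagonal-exists ∣ X ∣ X Y refl (sym ∣X∣≡∣Y∣))
    d = proj₂ (diagonal-exists ∣ X ∣ X Y refl (sym ∣X∣≡∣Y∣))

  length-diagonals : length (diagonals X Y) ≡ #diagonals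
  length-diagonals = countᵇ≡∑𝟙 (isDiagᵇ X Y) 𝒜

  #diagonals≡#good+#bad : #diagonals ≡ countᵇ good (diagonals X Y) + #bad
  #diagonals≡#good+#bad = begin
    #diagonals                                                ≡⟨ ∑-cong 𝒜 split ⟩
    ∑ (λ σ → diag σ * 𝟙 (good σ) + badDiag σ) 𝒜              ≡⟨ ∑-+ _ badDiag 𝒜 ⟩
    ∑ (λ σ → diag σ * 𝟙 (good σ)) 𝒜 + #bad                    ≡⟨ cong (_+ #bad) (∑-filterᵇ (𝟙 ∘ good) (isDiagᵇ X Y) 𝒜) ⟨
    ∑ (𝟙 ∘ good) (diagonals X Y) + #bad                       ≡⟨ cong (_+ #bad) (countᵇ≡∑𝟙 good (diagonals X Y)) ⟨
    countᵇ good (diagonals X Y) + #bad                        ∎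
    where
    open ≡-Reasoning
    split : ∀ σ → diag σ ≡ diag σ * 𝟙 (good σ) + badDiag σ
    split σ = trans (sym (*-identityʳ (diag σ)))
                (trans (cong (diag σ *_) (one (good σ))) (*-distribˡ-+ (diag σ) _ _))
      where
      one : ∀ b → 1 ≡ 𝟙 b + 𝟙 (not b)
      one true  = refl
      one false = refl

private
  ι : ℕ → ℚᵘ
  ι k = mkℚᵘ (ℤ.+ k) 0

  toℚᵘ-ℕtoℚ : ∀ k → toℚᵘ (ℕtoℚ k) ≃ ι k
  toℚᵘ-ℕtoℚ k = ℚ.toℚᵘ-fromℚᵘ (ι k)

  ι-+ : ∀ m n → ι (m + n) ≃ (ι m ℚᵘ.+ ι n)
  ι-+ m n = *≡* (identity (ℤ.+ m) (ℤ.+ n))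
    where
    identity : ∀ (a b : ℤ.ℤ) → (a ℤ.+ b) ℤ.* (ℤ.1ℤ ℤ.* ℤ.1ℤ) ≡ (a ℤ.* ℤ.1ℤ ℤ.+ b ℤ.* ℤ.1ℤ) ℤ.* ℤ.1ℤ
    identity = ℤ-Solver.solve-∀

  ι-* : ∀ m n → ι (m * n) ≃ (ι m ℚᵘ.* ι n)
  ι-* m n = *≡* (trans (cong (ℤ._* (ℤ.1ℤ ℤ.* ℤ.1ℤ)) (ℤ.pos-* m n)) (identity (ℤ.+ m) (ℤ.+ n)))
    where
    identity : ∀ (a b : ℤ.ℤ) → (a ℤ.* b) ℤ.* (ℤ.1ℤ ℤ.* ℤ.1ℤ) ≡ (a ℤ.* b) ℤ.* ℤ.1ℤ
    identity = ℤ-Solver.solve-∀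

ℕtoℚ-+ : ∀ m n → ℕtoℚ (m + n) ≡ ℕtoℚ m ℚ.+ ℕtoℚ n
ℕtoℚ-+ m n = ℚ.toℚᵘ-injective (begin-equality
  toℚᵘ (ℕtoℚ (m + n))                   ≃⟨ toℚᵘ-ℕtoℚ (m + n) ⟩
  ι (m + n)                             ≃⟨ ι-+ m n ⟩
  ι m ℚᵘ.+ ι n                          ≃⟨ ℚᵘ.+-cong (toℚᵘ-ℕtoℚ m) (toℚᵘ-ℕtoℚ n) ⟨
  toℚᵘ (ℕtoℚ m) ℚᵘ.+ toℚᵘ (ℕtoℚ n)      ≃⟨ ℚ.toℚᵘ-homo-+ (ℕtoℚ m) (ℕtoℚ n) ⟨
  toℚᵘ (ℕtoℚ m ℚ.+ ℕtoℚ n)              ∎)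
  where open ℚᵘ.≤-Reasoning

ℕtoℚ-* : ∀ m n → ℕtoℚ (m * n) ≡ ℕtoℚ m ℚ.* ℕtoℚ n
ℕtoℚ-* m n = ℚ.toℚᵘ-injective (begin-equality
  toℚᵘ (ℕtoℚ (m * n))                   ≃⟨ toℚᵘ-ℕtoℚ (m * n) ⟩
  ι (m * n)                             ≃⟨ ι-* m n ⟩
  ι m ℚᵘ.* ι n                          ≃⟨ ℚᵘ.*-cong (toℚᵘ-ℕtoℚ m) (toℚᵘ-ℕtoℚ n) ⟨
  toℚᵘ (ℕtoℚ m) ℚᵘ.* toℚᵘ (ℕtoℚ n)      ≃⟨ ℚ.toℚᵘ-homo-* (ℕtoℚ m) (ℕtoℚ n) ⟨
  toℚᵘ (ℕtoℚ m ℚ.* ℕtoℚ n)              ∎)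
  where open ℚᵘ.≤-Reasoning

ℕtoℚ-mono-≤ : ∀ {m n} → m ≤ n → ℕtoℚ m ℚ.≤ ℕtoℚ n
ℕtoℚ-mono-≤ {m} {n} m≤n = ℚ.toℚᵘ-cancel-≤ (begin
  toℚᵘ (ℕtoℚ m) ≃⟨ toℚᵘ-ℕtoℚ m ⟩
  ι m           ≤⟨ *≤* (ℤ.*-monoʳ-≤-nonNeg (ℤ.+ 1) (ℤ.+≤+ m≤n)) ⟩
  ι n           ≃⟨ toℚᵘ-ℕtoℚ n ⟨
  toℚᵘ (ℕtoℚ n) ∎)
  where open ℚᵘ.≤-Reasoning

ℕtoℚ-pos : ∀ {n} → 1 ≤ n → 0ℚ ℚ.< ℕtoℚ n
ℕtoℚ-pos {n} 1≤n = ℚ.toℚᵘ-cancel-< (begin-strict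
  toℚᵘ 0ℚ       ≡⟨⟩
  ι 0           <⟨ *<* (ℤ.*-monoʳ-<-pos (ℤ.+ 1) (ℤ.+<+ 1≤n)) ⟩
  ι n           ≃⟨ toℚᵘ-ℕtoℚ n ⟨
  toℚᵘ (ℕtoℚ n) ∎)
  where open ℚᵘ.≤-Reasoning

¬[1-q]*D≤G : ∀ (q : ℚ) {D G B M : ℕ} → D ≡ G + B → 1 ≤ D → D ≤ M * B →
             q ℚ.* ℕtoℚ M ℚ.< 1ℚ → ¬ ((1ℚ ℚ.- q) ℚ.* ℕtoℚ D ℚ.≤ ℕtoℚ G)
¬[1-q]*D≤G q {D} {G} {B} {M} D≡G+B 1≤D D≤MB qM<1 [1-q]d≤g = ℚ.<-irrefl refl (begin-strict
  d                  ≤⟨ subst (d ℚ.≤_) (ℕtoℚ-* M B) (ℕtoℚ-mono-≤ D≤MB) ⟩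
  m ℚ.* b            ≤⟨ ℚ.*-monoˡ-≤-nonNeg m {{ℚ.nonNegative (ℕtoℚ-mono-≤ {0} {M} z≤n)}} b≤qd ⟩
  m ℚ.* (q ℚ.* d)    ≡⟨ solve 3 (λ m q d → m :* (q :* d) := (q :* m) :* d) refl m q d ⟩
  (q ℚ.* m) ℚ.* d    <⟨ ℚ.*-monoˡ-<-pos d {{ℚ.positive (ℕtoℚ-pos 1≤D)}} qM<1 ⟩
  1ℚ ℚ.* d           ≡⟨ ℚ.*-identityˡ d ⟩
  d                  ∎)
  where
  open ℚ.≤-Reasoning
  open +-*-Solver
  d = ℕtoℚ D
  b = ℕtoℚ B
  m = ℕtoℚ M
  x = (1ℚ ℚ.- q) ℚ.* d
  b≤qd : b ℚ.≤ q ℚ.* d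
  b≤qd = begin
    b                        ≡⟨ solve 2 (λ x b → b := (x :+ b) :- x) refl x b ⟩
    (x ℚ.+ b) ℚ.- x          ≤⟨ ℚ.+-monoˡ-≤ (ℚ.- x) (ℚ.+-monoˡ-≤ b [1-q]d≤g) ⟩
    (ℕtoℚ G ℚ.+ b) ℚ.- x     ≡⟨ cong (ℚ._- x) (sym (trans (cong ℕtoℚ D≡G+B) (ℕtoℚ-+ G B))) ⟩
    d ℚ.- x                  ≡⟨ solve 2 (λ d q → d :- (con 1ℚ :- q) :* d := q :* d) refl d q ⟩
    q ℚ.* d                  ∎

zeroStrongLine? : (large : Fin n → Fin n → Bool) (X Y : Subset n) →
                  Dec (HasZeroStrongLine (λ i j → large i j ≡ true) X Y)
zeroStrongLine? large X Y =
  any? (λ i → i ∈? X ×-dec all? (λ j → j ∈? Y →-dec large i j Bool.≟ true))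
  ⊎-dec any? (λ j → j ∈? Y ×-dec all? (λ i → i ∈? X →-dec large i j Bool.≟ true))

q-good⇒zeroStrongLine : (large : Fin n → Fin n → Bool) (X Y : Subset n) → ∣ X ∣ ≡ ∣ Y ∣ → 1 ≤ ∣ X ∣ →
  (q : ℚ) → q ℚ.* ℕtoℚ (4 * ∣ X ∣) ℚ.< 1ℚ → QGood large X Y q →
  HasZeroStrongLine (λ i j → large i j ≡ true) X Y
q-good⇒zeroStrongLine large X Y ∣X∣≡∣Y∣ 1≤∣X∣ q q*4m<1 q-good =
  decidable-stable (zeroStrongLine? large X Y) λ no-line → ¬[1-q]*D≤G q
    {length (diagonals X Y)} {countᵇ good (diagonals X Y)} {#bad} {4 * ∣ X ∣}
    (trans length-diagonals #diagonals≡#good+#bad)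
    (subst (1 ≤_) (sym length-diagonals) (1≤#diagonals ∣X∣≡∣Y∣))
    (subst₂ (λ D m → D ≤ 4 * m * #bad) (sym length-diagonals) (sym ∣X∣≡∣Y∣)
      (no-strong-line⇒#diagonals≤4∣Y∣#bad (subst (1 ≤_) ∣X∣≡∣Y∣ 1≤∣X∣) no-line))
    q*4m<1 q-good
  where open Diagonals X Y large

HasZeroStrongLine-map : {X Y : Subset n} {P Q : Fin n → Fin n → Set} → (∀ {i j} → P i j → Q i j) →
                        HasZeroStrongLine P X Y → HasZeroStrongLine Q X Y
HasZeroStrongLine-map P⇒Q (inj₁ (i , i∈X , row)) = inj₁ (i , i∈X , λ j j∈Y → P⇒Q (row j j∈Y))
HasZeroStrongLine-map P⇒Q (inj₂ (j , j∈Y , col)) = inj₂ (j , j∈Y , λ i i∈X → P⇒Q (col i i∈X))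

lemma16 : (n : ℕ) → 1 ≤ n → (F : Perm n → Bool) → 2 * card n F ≡ n ! →
  (c : Fin n → Fin n → ℚ) → IsProjection n (fOf F) c →
  (X Y : Subset n) → ∣ X ∣ ≡ ∣ Y ∣ → 1 ≤ ∣ X ∣ →
  (q : ℚ) → q ℚ.* ℕtoℚ (4 * ∣ X ∣) ℚ.< ℚ.1ℚ →
  QGood (λ i j → largeᵇ (epsilon n (fOf F) c) (aCoef n (fOf F) i j)) X Y q →
  HasZeroStrongLine (λ i j → Large (epsilon n (fOf F) c) (aCoef n (fOf F) i j)) X Y
lemma16 n _ F _ c _ X Y ∣X∣≡∣Y∣ 1≤∣X∣ q q*4m<1 q-good =
  HasZeroStrongLine-map (λ large → toWitness (Equivalence.from T-≡ large))
    (q-good⇒zeroStrongLine large X Y ∣X∣≡∣Y∣ 1≤∣X∣ q q*4m<1 q-good)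
  where
  large : Fin n → Fin n → Bool
  large i j = largeᵇ (epsilon n (fOf F) c) (aCoef n (fOf F) i j)
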